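{- Let $a, b$ be nonzero integers, let $m, n$ be positive integers, and let $c_1, c_2$ be integers with $c_1 \neq c_2$. Let $X, Y \in M_2(\mathbb{Z})$. Then $$aX^m + bY^n = \begin{pmatrix} c_1 & 0 \\ 0 & c_2 \end{pmatrix} \quad\text{and}\quad XY = YX$$ if and only if $$X = \begin{pmatrix} x_1 & 0 \\ 0 & x_2 \end{pmatrix}, \quad Y = \begin{pmatrix} y_1 & 0 \\ 0 & y_2 \end{pmatrix},$$ where $x_1, x_2, y_1, y_2 \in \mathbb{Z}$ satisfy $a x_i^m + b y_i^n = c_i$ for $i = 1, 2$.
   Context: $M_2(\mathbb{Z})$ denotes the ring of $2\times 2$ matrices with integer entries. -}

module Defs where

open import Data.Nat using (ℕ; zero; suc)
open import Data.Integer using (ℤ; _+_; _*_; +_; 0ℤ; 1ℤ)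

record M₂ : Set where
  constructor mat
  field
    e11 e12 e21 e22 : ℤ
open M₂ public

infixl 6 _⊕_
infixl 7 _⊗_ _·_

_⊕_ : M₂ → M₂ → M₂
mat a b c d ⊕ mat a' b' c' d' = mat (a + a') (b + b') (c + c') (d + d')

_⊗_ : M₂ → M₂ → M₂
mat a b c d ⊗ mat a' b' c' d' =
  mat (a * a' + b * c') (a * b' + b * d') (c * a' + d * c') (c * b' + d * d')

_·_ : ℤ → M₂ → M₂
k · mat a b c d = mat (k * a) (k * b) (k * c) (k * d)

I₂ : M₂
I₂ = mat 1ℤ 0ℤ 0ℤ 1ℤ

_^ᴹ_ : M₂ → ℕ → M₂
X ^ᴹ zero = I₂
X ^ᴹ suc m = X ⊗ (X ^ᴹ m)

diag : ℤ → ℤ → M₂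
diag c₁ c₂ = mat c₁ 0ℤ 0ℤ c₂

-- Since X and Y commute, each of them commutes with aXᵐ + bYⁿ = diag(c₁, c₂),
-- and a matrix commuting with diag(c₁, c₂), c₁ ≠ c₂, is diagonal. For diagonal
-- X and Y the matrix equation splits into the two scalar equations on the diagonal.
module Submission where

open import Defs
open import Data.Nat using (ℕ; zero; suc) renaming (_<_ to _<ℕ_)
open import Data.Integer using (ℤ; _+_; _*_; _^_; 0ℤ; 1ℤ; +_; -[1+_])
open import Data.Integer.Properties using (*-comm; *-cancelʳ-≡)
open import Data.Integer.Tactic.RingSolver using (solve-∀)
open import Data.Product using (_×_; _,_; ∃-syntax)
open import Relation.Binary.PropositionalEquality
  using (_≡_; _≢_; refl; sym; trans; cong; cong₂; subst; module ≡-Reasoning)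
open import Relation.Nullary using (contradiction)
open import Function.Base using (_∘_)
open import Function.Bundles using (_⇔_; mk⇔)

open ≡-Reasoning

mat-cong : ∀ {p q r s p′ q′ r′ s′} → p ≡ p′ → q ≡ q′ → r ≡ r′ → s ≡ s′ →
           mat p q r s ≡ mat p′ q′ r′ s′
mat-cong refl refl refl refl = refl

Commute : M₂ → M₂ → Set
Commute A B = A ⊗ B ≡ B ⊗ A

⊗-assoc : ∀ A B C → (A ⊗ B) ⊗ C ≡ A ⊗ (B ⊗ C)
⊗-assoc (mat a b c d) (mat a′ b′ c′ d′) (mat a″ b″ c″ d″) =
  mat-cong (entry a b a′ b′ c′ d′ a″ c″) (entry a b a′ b′ c′ d′ b″ d″)
           (entry c d a′ b′ c′ d′ a″ c″) (entry c d a′ b′ c′ d′ b″ d″)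
  where
  entry : ∀ x y p q r s u v → (x * p + y * r) * u + (x * q + y * s) * v
                            ≡ x * (p * u + q * v) + y * (r * u + s * v)
  entry = solve-∀

⊗-identityˡ : ∀ A → I₂ ⊗ A ≡ A
⊗-identityˡ (mat a b c d) = mat-cong (entry a c) (entry b d) (entry′ a c) (entry′ b d)
  where
  entry : ∀ x y → 1ℤ * x + 0ℤ * y ≡ x
  entry = solve-∀
  entry′ : ∀ x y → 0ℤ * x + 1ℤ * y ≡ y
  entry′ = solve-∀

⊗-identityʳ : ∀ A → A ⊗ I₂ ≡ A
⊗-identityʳ (mat a b c d) = mat-cong (entry a b) (entry′ a b) (entry c d) (entry′ c d)
  where
  entry : ∀ x y → x * 1ℤ + y * 0ℤ ≡ x
  entry = solve-∀
  entry′ : ∀ x y → x * 0ℤ + y * 1ℤ ≡ y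
  entry′ = solve-∀

⊗-distribˡ-lincomb : ∀ k l A P Q → A ⊗ (k · P ⊕ l · Q) ≡ k · (A ⊗ P) ⊕ l · (A ⊗ Q)
⊗-distribˡ-lincomb k l (mat a b c d) (mat p q r s) (mat p′ q′ r′ s′) =
  mat-cong (entry k l a b p r p′ r′) (entry k l a b q s q′ s′)
           (entry k l c d p r p′ r′) (entry k l c d q s q′ s′)
  where
  entry : ∀ k l x y u v u′ v′ → x * (k * u + l * u′) + y * (k * v + l * v′)
                          ≡ k * (x * u + y * v) + l * (x * u′ + y * v′)
  entry = solve-∀

⊗-distribʳ-lincomb : ∀ k l A P Q → (k · P ⊕ l · Q) ⊗ A ≡ k · (P ⊗ A) ⊕ l · (Q ⊗ A)
⊗-distribʳ-lincomb k l (mat a b c d) (mat p q r s) (mat p′ q′ r′ s′) =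
  mat-cong (entry k l a c p q p′ q′) (entry k l b d p q p′ q′)
           (entry k l a c r s r′ s′) (entry k l b d r s r′ s′)
  where
  entry : ∀ k l x y u v u′ v′ → (k * u + l * u′) * x + (k * v + l * v′) * y
                          ≡ k * (u * x + v * y) + l * (u′ * x + v′ * y)
  entry = solve-∀

commute-^ᴹ : ∀ {A B} k → Commute A B → Commute A (B ^ᴹ k)
commute-^ᴹ {A} zero _ = trans (⊗-identityʳ A) (sym (⊗-identityˡ A))
commute-^ᴹ {A} {B} (suc k) AB = begin
  A ⊗ (B ⊗ B ^ᴹ k)   ≡⟨ sym (⊗-assoc A B (B ^ᴹ k)) ⟩
  (A ⊗ B) ⊗ B ^ᴹ k   ≡⟨ cong (_⊗ B ^ᴹ k) AB ⟩
  (B ⊗ A) ⊗ B ^ᴹ k   ≡⟨ ⊗-assoc B A (B ^ᴹ k) ⟩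
  B ⊗ (A ⊗ B ^ᴹ k)   ≡⟨ cong (B ⊗_) (commute-^ᴹ k AB) ⟩
  B ⊗ (B ^ᴹ k ⊗ A)   ≡⟨ sym (⊗-assoc B (B ^ᴹ k) A) ⟩
  (B ⊗ B ^ᴹ k) ⊗ A   ∎

commute-lincomb : ∀ {A P Q} k l → Commute A P → Commute A Q → Commute A (k · P ⊕ l · Q)
commute-lincomb {A} {P} {Q} k l AP AQ = begin
  A ⊗ (k · P ⊕ l · Q)           ≡⟨ ⊗-distribˡ-lincomb k l A P Q ⟩
  k · (A ⊗ P) ⊕ l · (A ⊗ Q)     ≡⟨ cong₂ (λ U V → k · U ⊕ l · V) AP AQ ⟩
  k · (P ⊗ A) ⊕ l · (Q ⊗ A)     ≡⟨ sym (⊗-distribʳ-lincomb k l A P Q) ⟩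
  (k · P ⊕ l · Q) ⊗ A           ∎

≢-*ʳ⇒≡0 : ∀ {i j} k → i ≢ j → i * k ≡ j * k → k ≡ 0ℤ
≢-*ʳ⇒≡0         (+ zero)     _   _     = refl
≢-*ʳ⇒≡0 {i} {j} k@(+ suc _)  i≢j ik≡jk = contradiction (*-cancelʳ-≡ i j k ik≡jk) i≢j
≢-*ʳ⇒≡0 {i} {j} k@(-[1+ _ ]) i≢j ik≡jk = contradiction (*-cancelʳ-≡ i j k ik≡jk) i≢j

-- Comparing off-diagonal entries of A ⊗ D and D ⊗ A gives c₂ q = c₁ q and c₁ r = c₂ r.
commute-diag⇒diagonal : ∀ {c₁ c₂} A → c₁ ≢ c₂ → Commute A (diag c₁ c₂) → A ≡ diag (e11 A) (e22 A)
commute-diag⇒diagonal {c₁} {c₂} (mat p q r s) c₁≢c₂ AD≡DA =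
  mat-cong refl
    (≢-*ʳ⇒≡0 q (c₁≢c₂ ∘ sym) (trans (sym (upper p q c₂)) (trans (cong e12 AD≡DA) (upper′ s q c₁))))
    (≢-*ʳ⇒≡0 r c₁≢c₂ (trans (sym (lower r s c₁)) (trans (cong e21 AD≡DA) (lower′ p r c₂))))
    refl
  where
  upper : ∀ x y c → x * 0ℤ + y * c ≡ c * y
  upper = solve-∀
  upper′ : ∀ x y c → c * y + 0ℤ * x ≡ c * y
  upper′ = solve-∀
  lower : ∀ x y c → x * c + y * 0ℤ ≡ c * x
  lower = solve-∀
  lower′ : ∀ x y c → 0ℤ * x + c * y ≡ c * y
  lower′ = solve-∀

diag-⊗ : ∀ x₁ x₂ y₁ y₂ → diag x₁ x₂ ⊗ diag y₁ y₂ ≡ diag (x₁ * y₁) (x₂ * y₂)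
diag-⊗ x₁ x₂ y₁ y₂ =
  mat-cong (first x₁ y₁) (upper x₁ y₂) (lower y₁ x₂) (second x₂ y₂)
  where
  first : ∀ x y → x * y + 0ℤ * 0ℤ ≡ x * y
  first = solve-∀
  second : ∀ x y → 0ℤ * 0ℤ + x * y ≡ x * y
  second = solve-∀
  upper : ∀ x y → x * 0ℤ + 0ℤ * y ≡ 0ℤ
  upper = solve-∀
  lower : ∀ x y → 0ℤ * x + y * 0ℤ ≡ 0ℤ
  lower = solve-∀

diag-commute : ∀ x₁ x₂ y₁ y₂ → Commute (diag x₁ x₂) (diag y₁ y₂)
diag-commute x₁ x₂ y₁ y₂ = begin
  diag x₁ x₂ ⊗ diag y₁ y₂       ≡⟨ diag-⊗ x₁ x₂ y₁ y₂ ⟩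
  diag (x₁ * y₁) (x₂ * y₂)      ≡⟨ cong₂ diag (*-comm x₁ y₁) (*-comm x₂ y₂) ⟩
  diag (y₁ * x₁) (y₂ * x₂)      ≡⟨ sym (diag-⊗ y₁ y₂ x₁ x₂) ⟩
  diag y₁ y₂ ⊗ diag x₁ x₂       ∎

diag-^ᴹ : ∀ x₁ x₂ k → diag x₁ x₂ ^ᴹ k ≡ diag (x₁ ^ k) (x₂ ^ k)
diag-^ᴹ x₁ x₂ zero    = refl
diag-^ᴹ x₁ x₂ (suc k) = begin
  diag x₁ x₂ ⊗ diag x₁ x₂ ^ᴹ k        ≡⟨ cong (diag x₁ x₂ ⊗_) (diag-^ᴹ x₁ x₂ k) ⟩
  diag x₁ x₂ ⊗ diag (x₁ ^ k) (x₂ ^ k) ≡⟨ diag-⊗ x₁ x₂ (x₁ ^ k) (x₂ ^ k) ⟩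
  diag (x₁ ^ suc k) (x₂ ^ suc k)       ∎

lincomb-diag : ∀ k l x₁ x₂ y₁ y₂ →
  k · diag x₁ x₂ ⊕ l · diag y₁ y₂ ≡ diag (k * x₁ + l * y₁) (k * x₂ + l * y₂)
lincomb-diag k l _ _ _ _ = mat-cong refl (off k l) (off k l) refl
  where
  off : ∀ k l → k * 0ℤ + l * 0ℤ ≡ 0ℤ
  off = solve-∀

lincomb-diag-^ᴹ : ∀ k l m n x₁ x₂ y₁ y₂ →
  k · (diag x₁ x₂ ^ᴹ m) ⊕ l · (diag y₁ y₂ ^ᴹ n)
    ≡ diag (k * x₁ ^ m + l * y₁ ^ n) (k * x₂ ^ m + l * y₂ ^ n)
lincomb-diag-^ᴹ k l m n x₁ x₂ y₁ y₂ =
  trans (cong₂ (λ P Q → k · P ⊕ l · Q) (diag-^ᴹ x₁ x₂ m) (diag-^ᴹ y₁ y₂ n))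
        (lincomb-diag k l (x₁ ^ m) (x₂ ^ m) (y₁ ^ n) (y₂ ^ n))

diag-injective : ∀ {x₁ x₂ y₁ y₂} → diag x₁ x₂ ≡ diag y₁ y₂ → x₁ ≡ y₁ × x₂ ≡ y₂
diag-injective refl = refl , refl

commuting-solution⇒diagonal : ∀ k l m n {c₁ c₂ X Y} → c₁ ≢ c₂ →
  k · (X ^ᴹ m) ⊕ l · (Y ^ᴹ n) ≡ diag c₁ c₂ → Commute X Y →
  X ≡ diag (e11 X) (e22 X) × Y ≡ diag (e11 Y) (e22 Y)
commuting-solution⇒diagonal k l m n {c₁} {c₂} {X} {Y} c₁≢c₂ eq XY =
  commute-diag⇒diagonal X c₁≢c₂ (commute-D (commute-^ᴹ m refl) (commute-^ᴹ n XY)) ,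
  commute-diag⇒diagonal Y c₁≢c₂ (commute-D (commute-^ᴹ m (sym XY)) (commute-^ᴹ n refl))
  where
  commute-D : ∀ {Z} → Commute Z (X ^ᴹ m) → Commute Z (Y ^ᴹ n) → Commute Z (diag c₁ c₂)
  commute-D ZXᵐ ZYⁿ = subst (Commute _) eq (commute-lincomb k l ZXᵐ ZYⁿ)

proposition2p1 : (a b : ℤ) → a ≢ 0ℤ → b ≢ 0ℤ
    → (m n : ℕ) → 0 <ℕ m → 0 <ℕ n
    → (c₁ c₂ : ℤ) → c₁ ≢ c₂ → (X Y : M₂)
    → ((a · (X ^ᴹ m) ⊕ b · (Y ^ᴹ n) ≡ diag c₁ c₂) × (X ⊗ Y ≡ Y ⊗ X))
      ⇔ (∃[ x₁ ] ∃[ x₂ ] ∃[ y₁ ] ∃[ y₂ ]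
          ((X ≡ diag x₁ x₂) × (Y ≡ diag y₁ y₂)
           × (a * x₁ ^ m + b * y₁ ^ n ≡ c₁) × (a * x₂ ^ m + b * y₂ ^ n ≡ c₂)))
proposition2p1 a b _ _ m n _ _ c₁ c₂ c₁≢c₂ X Y = mk⇔
  (λ (eq , XY) → let (X≡D , Y≡D) = commuting-solution⇒diagonal a b m n c₁≢c₂ eq XY in
    e11 X , e22 X , e11 Y , e22 Y , X≡D , Y≡D ,
    diag-injective (begin
      diag _ _                                   ≡⟨ sym (lincomb-diag-^ᴹ a b m n _ _ _ _) ⟩
      a · (diag _ _ ^ᴹ m) ⊕ b · (diag _ _ ^ᴹ n)  ≡⟨ cong₂ (λ P Q → a · (P ^ᴹ m) ⊕ b · (Q ^ᴹ n))
                                                          (sym X≡D) (sym Y≡D) ⟩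
      a · (X ^ᴹ m) ⊕ b · (Y ^ᴹ n)                ≡⟨ eq ⟩
      diag c₁ c₂                                 ∎))
  (λ { (x₁ , x₂ , y₁ , y₂ , refl , refl , eq₁ , eq₂) →
    trans (lincomb-diag-^ᴹ a b m n x₁ x₂ y₁ y₂) (cong₂ diag eq₁ eq₂) ,
    diag-commute x₁ x₂ y₁ y₂ })
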